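{- Let $A=\{a\}$ and $\mathtt{P}=\{p\}$. Let $M=\langle W,R,V\rangle$ with $W=\{w_0,w_1\}$, $R_a=W\times W$, $V(p)=\{w_0\}$. Then there are no $S\subseteq A$ and $\chi\in\mathcal{L}_D$ such that the models $M^{S,\chi}$ and $M^{!p}$ are collectively $\mathtt{P}$-bisimilar (i.e., there is no collective $\mathtt{P}$-bisimulation between them).
   Context: A model is $M=\langle W,R,V\rangle$ with $W$ non-empty, $R=\{R_i\subseteq W\times W\mid i\in A\}$, $V:\mathtt{P}\to\mathcal{P}(W)$; $R_G:=\bigcap_{k\in G}R_k$ (with $R_\emptyset:=W\times W$). $\mathcal{L}_D$: $\varphi::=p\mid\lnot\varphi\mid\varphi\land\varphi\mid D_G\varphi$ ($\emptyset\neq G\subseteq A$), with $(M,w)\Vdash D_G\varphi$ iff $\varphi$ holds at all $u$ with $(w,u)\in R_G$. $\|\chi\|^M$ is the truth set of $\chi$ in $M$; $\sim^M_\chi:=(\|\chi\|^M\times\|\chi\|^M)\cup(\|\lnot\chi\|^M\times\|\lnot\chi\|^M)$. Partial communication: $M^{S,\chi}=\langle W,R^{S,\chi},V\rangle$ with $R^{S,\chi}_i:=R_i\cap(R_S\cup\sim^M_\chi)$. Public announcement: $M^{!\xi}=\langle W,R^{!\xi},V\rangle$ with $R^{!\xi}_i:=R_i\cap\sim^M_\xi$. A collective $\mathtt{P}$-bisimulation between $M=\langle W,R,V\rangle$ and $M'=\langle W',R',V'\rangle$ is a non-empty $Z\subseteq W\times W'$ such that for every $(u,u')\in Z$: $u,u'$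 satisfy the same atoms; for every $G\subseteq A$ and $(u,v)\in R_G$ there is $v'$ with $(u',v')\in R'_G$, $(v,v')\in Z$; and symmetrically for $(u',v')\in R'_G$. -}

module Defs where

open import Data.Bool using (Bool; true; false)
open import Data.Unit using (⊤; tt)
open import Data.Product using (Σ; _×_; _,_; ∃)
open import Data.Sum using (_⊎_)
open import Relation.Nullary using (¬_)
open import Relation.Binary.PropositionalEquality using (_≡_)

Subset : Set → Set
Subset A = A → Bool

NonEmpty : {A : Set} → Subset A → Set
NonEmpty {A} G = Σ A (λ k → G k ≡ true)

data Form (A P : Set) : Set where
  atom : P → Form A P
  neg  : Form A P → Form A P
  conj : Form A P → Form A P → Form A P
  D    : (G : Subset A) → NonEmpty G → Form A P → Form A P

record Model (A P : Set) : Set₁ where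
  field
    W  : Set
    w∗ : W
    R  : A → W → W → Set
    V  : P → W → Set
open Model public

-- R_G := ⋂_{k ∈ G} R_k  (so R_∅ = W × W)
RG : {A P : Set} (M : Model A P) → Subset A → W M → W M → Set
RG M G u v = ∀ k → G k ≡ true → R M k u v

_,_⊩_ : {A P : Set} (M : Model A P) → W M → Form A P → Set
M , w ⊩ atom p     = V M p w
M , w ⊩ neg φ      = ¬ (M , w ⊩ φ)
M , w ⊩ conj φ ψ   = (M , w ⊩ φ) × (M , w ⊩ ψ)
M , w ⊩ D G _ φ    = ∀ u → RG M G w u → M , u ⊩ φ

Sim : {A P : Set} (M : Model A P) → Form A P → W M → W M → Set
Sim M χ u v = ((M , u ⊩ χ) × (M , v ⊩ χ)) ⊎ ((M , u ⊩ neg χ) × (M , v ⊩ neg χ))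

partialComm : {A P : Set} (M : Model A P) → Subset A → Form A P → Model A P
partialComm M S χ = record
  { W = W M ; w∗ = w∗ M ; V = V M
  ; R = λ i u v → R M i u v × (RG M S u v ⊎ Sim M χ u v) }

announce : {A P : Set} (M : Model A P) → Form A P → Model A P
announce M ξ = record
  { W = W M ; w∗ = w∗ M ; V = V M
  ; R = λ i u v → R M i u v × Sim M ξ u v }

record IsCollBisim {A P : Set} (M M' : Model A P) (Z : W M → W M' → Set) : Set where
  field
    nonempty : Σ (W M) (λ u → Σ (W M') (λ u' → Z u u'))
    atoms    : ∀ u u' → Z u u' → ∀ p → (V M p u → V M' p u') × (V M' p u' → V M p u)
    forth    : ∀ u u' → Z u u' → ∀ (G : Subset A) v → RG M G u v →
               Σ (W M') (λ v' → RG M' G u' v' × Z v v')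
    back     : ∀ u u' → Z u u' → ∀ (G : Subset A) v' → RG M' G u' v' →
               Σ (W M) (λ v → RG M G u v × Z v v')

CollBisimilar : {A P : Set} → Model A P → Model A P → Set₁
CollBisimilar M M' = Σ (W M → W M' → Set) (IsCollBisim M M')

data W2 : Set where
  w0 w1 : W2

M33 : Model ⊤ ⊤
M33 = record
  { W = W2 ; w∗ = w0
  ; R = λ _ _ _ → ⊤
  ; V = λ _ w → w ≡ w0 }

{-# OPTIONS --safe #-}
module Submission where

open import Defs
open import Data.Unit using (⊤; tt)
open import Data.Bool using (true)
open import Data.Empty using (⊥-elim)
open import Data.Product using (_×_; _,_; proj₁; proj₂)
open import Data.Sum using (inj₁; inj₂)
open import Relation.Nullary using (¬_)
open import Relation.Binary.PropositionalEquality using (refl)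

-- Since R_a is total in M, so is R_S, and therefore partial communication
-- removes no edge at all: M^{S,χ} is M.  The announcement of p, on the other
-- hand, cuts every edge between a p-world and a ¬p-world.  A bisimulation
-- must transport "every R_a-step preserves p" from M^{!p} back to M^{S,χ},
-- which fails there for the step w0 → w1.

AgreeOn : {A P : Set} (M : Model A P) → P → W M → W M → Set
AgreeOn M p u v = (V M p u → V M p v) × (V M p v → V M p u)

RG-partialComm-total : {A P : Set} (M : Model A P) (S : Subset A) (χ : Form A P) →
                       (∀ i u v → R M i u v) →
                       ∀ G u v → RG (partialComm M S χ) G u v
RG-partialComm-total M S χ total G u v k _ = total k u v , inj₁ (λ j _ → total j u v)

RG-announce-agreeOn : {A P : Set} (M : Model A P) (p : P) (G : Subset A) → NonEmpty G →
                      ∀ u v → RG (announce M (atom p)) G u v → AgreeOn M p u v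
RG-announce-agreeOn M p G (k , k∈G) u v uRv with proj₂ (uRv k k∈G)
... | inj₁ (pu , pv)   = (λ _ → pv) , (λ _ → pu)
... | inj₂ (¬pu , ¬pv) = (λ pu → ⊥-elim (¬pu pu)) , (λ pv → ⊥-elim (¬pv pv))

agreeOn-reflect : {A P : Set} {M M' : Model A P} {Z : W M → W M' → Set} →
                  IsCollBisim M M' Z → (p : P) (G : Subset A) →
                  (∀ u' v' → RG M' G u' v' → AgreeOn M' p u' v') →
                  ∀ u u' v → Z u u' → RG M G u v → AgreeOn M p u v
agreeOn-reflect {M = M} {M'} {Z} isb p G agree' u u' v uZu' uRv
  with IsCollBisim.forth isb u u' uZu' G v uRv
... | v' , u'Rv' , vZv' =
  (λ pu → proj₂ (atoms v v' vZv') (proj₁ (agree' u' v' u'Rv') (proj₁ (atoms u u' uZu') pu))) ,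
  (λ pv → proj₂ (atoms u u' uZu') (proj₂ (agree' u' v' u'Rv') (proj₁ (atoms v v' vZv') pv)))
  where
  atoms : ∀ w w' → Z w w' → (V M p w → V M' p w') × (V M' p w' → V M p w)
  atoms w w' wZw' = IsCollBisim.atoms isb w w' wZw' p

other : W2 → W2
other w0 = w1
other w1 = w0

M33-disagree-other : ∀ u → ¬ AgreeOn M33 tt u (other u)
M33-disagree-other w0 (to , _) with to refl
... | ()
M33-disagree-other w1 (_ , from) with from refl
... | ()

fact3p3 : (S : Subset ⊤) (χ : Form ⊤ ⊤) →
    ¬ CollBisimilar (partialComm M33 S χ) (announce M33 (atom tt))
fact3p3 S χ (Z , isb) with IsCollBisim.nonempty isb
... | u , u' , uZu' =
  M33-disagree-other u
    (agreeOn-reflect isb tt everyone everyone-agree u u' (other u) uZu'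
       (RG-partialComm-total M33 S χ (λ _ _ _ → tt) everyone u (other u)))
  where
  everyone : Subset ⊤
  everyone _ = true

  everyone-agree : ∀ v w → RG (announce M33 (atom tt)) everyone v w → AgreeOn M33 tt v w
  everyone-agree = RG-announce-agreeOn M33 tt everyone (tt , refl)
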